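{- Let $k\ge0$ and $\tau\ge1$ be integers. Then there exists an integer $K\ge0$ such that every blockade $\mathcal{B}=(B_1,\ldots,B_K)$ in a graph has a sub-blockade of length $k$ which is $\tau$-support-uniform.
   Context: A blockade in a graph $G$ is a sequence $(B_i:i\in I)$ of pairwise disjoint nonempty subsets (blocks) of $V(G)$, $I$ a finite set of integers; its length is $|I|$. A sub-blockade is $(B_i:i\in I')$ for some $I'\subseteq I$. An induced subgraph $H$ is $\mathcal{B}$-rainbow if each vertex lies in some block and no two lie in the same block; its support is the set of $i$ with $V(H)\cap B_i\ne\emptyset$; its $\mathcal{B}$-ordering orders $u<v$ if $u\in B_i$, $v\in B_j$ with $i<j$. An ordered tree is a tree with a linear order on its vertices (natural isomorphism notion). The trace of an ordered tree $J$ relative to $\mathcal{B}$ is the set of supports of all $\mathcal{B}$-rainbow induced subgraphs whose $\mathcal{B}$-ordering is isomorphic to $J$. A blockade $(B_i:i\in I)$ is $\tau$-support-uniform if for every ordered tree $J$ with $|J|\le\tau$, the trace of $J$ is either empty or equal to the set of all subsets of $I$ of cardinality $|J|$. -}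

module Defs where

open import Data.Nat using (ℕ; zero; suc; _≤_; _<_)
open import Data.Fin as Fin using (Fin; zero; suc; inject₁; fromℕ)
open import Data.Fin.Subset using (Subset; _∈_)
open import Data.Bool using (Bool; true; false)
open import Data.Product using (Σ; _×_; ∃; ∃-syntax; _,_)
open import Data.Sum using (_⊎_)
open import Relation.Binary.PropositionalEquality using (_≡_; _≢_)
open import Relation.Nullary using (¬_)
open import Function.Bundles using (_⇔_)

record Graph (n : ℕ) : Set where
  field
    adj   : Fin n → Fin n → Bool
    sym   : ∀ u v → adj u v ≡ adj v u
    irrefl : ∀ v → adj v v ≡ false
open Graph public

StrictInc : ∀ {a b} → (Fin a → Fin b) → Set
StrictInc {a} f = ∀ (i j : Fin a) → i Fin.< j → f i Fin.< f j

data Walk {m : ℕ} (G : Graph m) : Fin m → Fin m → Set where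
  here : ∀ {u} → Walk G u u
  step : ∀ {u w v} → adj G u w ≡ true → Walk G w v → Walk G u v

Connected : ∀ {m} → Graph m → Set
Connected G = ∀ u v → Walk G u v

record Cycle {m : ℕ} (G : Graph m) : Set where
  field
    l      : ℕ
    c      : Fin (suc (suc (suc l))) → Fin m
    inj    : ∀ i j → c i ≡ c j → i ≡ j
    consec : ∀ (i : Fin (suc (suc l))) → adj G (c (inject₁ i)) (c (suc i)) ≡ true
    close  : adj G (c (fromℕ (suc (suc l)))) (c zero) ≡ true

Acyclic : ∀ {m} → Graph m → Set
Acyclic G = ¬ Cycle G

record IsTree {m : ℕ} (T : Graph m) : Set where
  field
    nonempty  : 1 ≤ m
    connected : Connected T
    acyclic   : Acyclic T

-- An ordered tree with m vertices: vertex set Fin m, linearly ordered by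
-- the natural order of Fin m.
record OrderedTree (m : ℕ) : Set where
  field
    tree   : Graph m
    isTree : IsTree tree
open OrderedTree public

-- Blockades (B_i : i ∈ I) with I = {0,…,K-1} (i.e. B₁,…,B_K).

record Blockade {n : ℕ} (G : Graph n) (K : ℕ) : Set where
  field
    block    : Fin K → Subset n
    nonempty : ∀ i → ∃[ v ] v ∈ block i
    disjoint : ∀ i j → i ≢ j → ∀ v → v ∈ block i → ¬ (v ∈ block j)
open Blockade public

-- The sub-blockade (B_{f(0)},…,B_{f(k-1)}) for a strictly increasing
-- f : Fin k → Fin K (i.e. index set I' = image of f, with its order).
subBlock : ∀ {n K k} {G : Graph n} → Blockade G K → (Fin k → Fin K) → Fin k → Subset n
subBlock B f i = block B (f i)

-- A B-rainbow induced subgraph H whose B-ordering is isomorphic to the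
-- ordered tree J (on Fin m) is given, via that (unique) order isomorphism,
-- by an assignment h : Fin m → V(G) of vertices together with strictly
-- increasing block indices s : Fin m → Fin k with h a ∈ B_{s a}
-- (so the vertices lie in distinct blocks, and the B-ordering of H
-- corresponds to the order of Fin m) and such that h is an isomorphism
-- of induced subgraphs: adjacency in G agrees with adjacency in J.

record RainbowCopy {n k m : ℕ} (G : Graph n) (Bl : Fin k → Subset n)
                   (J : OrderedTree m) : Set where
  field
    h      : Fin m → Fin n
    s      : Fin m → Fin k
    s-inc  : StrictInc s
    inBlk  : ∀ a → h a ∈ Bl (s a)
    induced : ∀ a b → a ≢ b → adj G (h a) (h b) ≡ adj (tree J) a b
open RainbowCopy public

IsSupport : ∀ {n k m} {G : Graph n} {Bl : Fin k → Subset n} {J : OrderedTree m}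
            → RainbowCopy G Bl J → Subset k → Set
IsSupport {k = k} H S = ∀ (i : Fin k) → (i ∈ S) ⇔ (∃[ a ] s H a ≡ i)

InTrace : ∀ {n k m} (G : Graph n) (Bl : Fin k → Subset n) (J : OrderedTree m)
          → Subset k → Set
InTrace G Bl J S = Σ (RainbowCopy G Bl J) λ H → IsSupport H S

SupportUniform : ∀ {n k} (τ : ℕ) (G : Graph n) (Bl : Fin k → Subset n) → Set
SupportUniform {k = k} τ G Bl =
  ∀ (m : ℕ) (J : OrderedTree m) → m ≤ τ →
    (∀ (S : Subset k) → ¬ InTrace G Bl J S)
    ⊎ (∀ (S : Subset k) → InTrace G Bl J S ⇔ (Data.Fin.Subset.∣ S ∣ ≡ m))

-- For each ordered tree J on m ≤ τ vertices, colour an increasing m-tuple of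
-- block indices by whether some rainbow induced copy of J occupies exactly
-- those blocks, in that order. Up to isomorphism there are finitely many such
-- J, so applying Ramsey's theorem for m-uniform hypergraphs once per colouring
-- yields k blocks on which every colouring is constant. On these blocks the
-- trace of J is empty if its colour is "no", and if it is "yes" the trace is
-- the set of all m-subsets, since a support of a copy has exactly m elements
-- and every m-subset is the support of its increasing enumeration.
module Submission where

open import Defs hiding (sym)
open import Data.Nat using (ℕ; _≤_)
open import Data.Fin using (Fin)
open import Data.Product using (Σ; _×_; ∃; ∃-syntax)

open import Level using (0ℓ)
open import Data.Nat as ℕ using (zero; suc; _+_; z≤n; s≤s; s≤s⁻¹)
open import Data.Nat.Properties using (+-monoʳ-<)
open import Data.Fin as Fin using (zero; suc; _↑ˡ_; _↑ʳ_; punchOut)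
open import Data.Fin.Properties
  using (0≢1+n; suc-injective; toℕ-↑ˡ; toℕ-↑ʳ; punchIn-punchOut; any?; all?)
open import Data.Fin.Subset using (Subset; ∣_∣; _∈_)
open import Data.Fin.Subset.Properties using (_∈?_; drop-there)
open import Data.Vec as Vec using (Vec; lookup; tabulate; here; there)
open import Data.Vec.Properties using (lookup∘tabulate)
open import Data.Vec.Functional using (_∷_)
open import Data.Bool using (Bool; true; false)
import Data.Bool as Bool
open import Data.List as List using (List; [_]; map; concatMap; cartesianProductWith; upTo)
import Data.List.Relation.Unary.Any as Any
open import Data.List.Membership.Propositional using (lose) renaming (_∈_ to _∈ᴸ_)
open import Data.List.Membership.Propositional.Properties
  using (∈-map⁺; ∈-concatMap⁺; ∈-cartesianProductWith⁺; ∈-upTo⁺)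
open import Data.Product as Product using (_,_; proj₁; proj₂; map₂)
open import Data.Sum as Sum using (_⊎_; inj₁; inj₂)
open import Data.Empty using (⊥-elim)
open import Relation.Nullary using (¬_; Dec; yes; no)
open import Relation.Nullary.Decidable using (_×-dec_; _→-dec_; ¬?)
open import Relation.Unary using (Pred; Decidable; ∁)
open import Relation.Binary.Definitions using (_Respects_)
open import Relation.Binary.PropositionalEquality
  using (_≡_; _≢_; _≗_; refl; sym; trans; cong; cong₂; subst; subst₂)
open import Function using (_∘_; id; case_of_)
open import Function.Bundles using (_⇔_; mk⇔; Equivalence)

open Equivalence using (to; from)

StrictInc-∘ : ∀ {a b c} {f : Fin b → Fin c} {t : Fin a → Fin b} →
              StrictInc f → StrictInc t → StrictInc (f ∘ t)
StrictInc-∘ f↑ t↑ i j i<j = f↑ _ _ (t↑ i j i<j)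

StrictInc-suc : ∀ {a b} {t : Fin a → Fin b} → StrictInc t → StrictInc (suc ∘ t)
StrictInc-suc t↑ i j i<j = s≤s (t↑ i j i<j)

StrictInc-cons : ∀ {a b} {t : Fin a → Fin b} → StrictInc t → StrictInc (zero ∷ suc ∘ t)
StrictInc-cons t↑ zero    (suc j) _         = s≤s z≤n
StrictInc-cons t↑ (suc i) (suc j) (s≤s i<j) = s≤s (t↑ i j i<j)

StrictInc-↑ˡ : ∀ {a} b → StrictInc (λ (i : Fin a) → i ↑ˡ b)
StrictInc-↑ˡ b i j i<j = subst₂ ℕ._<_ (sym (toℕ-↑ˡ i b)) (sym (toℕ-↑ˡ j b)) i<j

StrictInc-↑ʳ : ∀ a {b} → StrictInc (λ (i : Fin b) → a ↑ʳ i)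
StrictInc-↑ʳ a i j i<j = subst₂ ℕ._<_ (sym (toℕ-↑ʳ a i)) (sym (toℕ-↑ʳ a j)) (+-monoʳ-< a i<j)

factorThroughSuc : ∀ {m k} (s : Fin m → Fin (suc k)) → StrictInc s → (∀ i → s i ≢ zero) →
                   Σ (Fin m → Fin k) λ s′ → StrictInc s′ × s ≗ suc ∘ s′
factorThroughSuc s s↑ s≢0 = s′ , s′↑ , s≗suc∘s′
  where
  s′ : _ → _
  s′ i = punchOut (s≢0 i ∘ sym)
  s≗suc∘s′ : s ≗ suc ∘ s′
  s≗suc∘s′ i = sym (punchIn-punchOut (s≢0 i ∘ sym))
  s′↑ : StrictInc s′
  s′↑ i j i<j = s≤s⁻¹ (subst₂ Fin._<_ (s≗suc∘s′ i) (s≗suc∘s′ j) (s↑ i j i<j))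

data Split : ∀ {m k} → (Fin m → Fin (suc k)) → Set where
  hitsZero   : ∀ {m k} {s : Fin (suc m) → Fin (suc k)} (s′ : Fin m → Fin k) →
               StrictInc s′ → s ≗ zero ∷ suc ∘ s′ → Split s
  avoidsZero : ∀ {m k} {s : Fin m → Fin (suc k)} (s′ : Fin m → Fin k) →
               StrictInc s′ → s ≗ suc ∘ s′ → Split s

StrictInc-tail≢zero : ∀ {m k} {s : Fin (suc m) → Fin (suc k)} → StrictInc s → ∀ i → s (suc i) ≢ zero
StrictInc-tail≢zero {s = s} s↑ i s[1+i]≡0
  with () ← subst (s zero Fin.<_) s[1+i]≡0 (s↑ zero (suc i) (s≤s z≤n))

split : ∀ {m k} {s : Fin m → Fin (suc k)} → StrictInc s → Split s
split {zero}          _  = avoidsZero (λ ()) (λ ()) (λ ())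
split {suc m} {s = s} s↑ with s zero in s₀
... | zero  = let s′ , s′↑ , eq = factorThroughSuc (s ∘ suc) (λ i j → s↑ (suc i) (suc j) ∘ s≤s)
                                                  (StrictInc-tail≢zero s↑)
              in  hitsZero s′ s′↑ λ { zero → s₀ ; (suc i) → eq i }
... | suc _ = let s′ , s′↑ , eq = factorThroughSuc s s↑ λ where
                                    zero    s₀≡0 → 0≢1+n (trans (sym s₀≡0) s₀)
                                    (suc i)      → StrictInc-tail≢zero s↑ i
              in  avoidsZero s′ s′↑ eq

IsImage : ∀ {m k} → (Fin m → Fin k) → Subset k → Set
IsImage {k = k} s S = ∀ (i : Fin k) → (i ∈ S) ⇔ (∃[ a ] s a ≡ i)

IsImage-resp : ∀ {m k} {s s′ : Fin m → Fin k} {S} → s ≗ s′ → IsImage s S → IsImage s′ S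
IsImage-resp eq img i = mk⇔ (map₂ (λ {a} → trans (sym (eq a))) ∘ to (img i))
                            (from (img i) ∘ map₂ (λ {a} → trans (eq a)))

image-suc⁻ : ∀ {m k b} {s : Fin m → Fin k} {S} → IsImage (suc ∘ s) (b Vec.∷ S) → IsImage s S
image-suc⁻ img i = mk⇔ (map₂ suc-injective ∘ to (img (suc i)) ∘ there)
                       (drop-there ∘ from (img (suc i)) ∘ map₂ (cong suc))

image-suc⁺ : ∀ {m k} {s : Fin m → Fin k} {S} → IsImage s S → IsImage (suc ∘ s) (false Vec.∷ S)
image-suc⁺ img zero    = mk⇔ (λ ()) λ ()
image-suc⁺ img (suc i) = mk⇔ (λ { (there p) → map₂ (cong suc) (to (img i) p) })
                             (there ∘ from (img i) ∘ map₂ suc-injective)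

image-cons⁻ : ∀ {m k b} {s : Fin m → Fin k} {S} →
              IsImage (zero ∷ suc ∘ s) (b Vec.∷ S) → IsImage s S
image-cons⁻ img i = mk⇔ (λ p → shift (to (img (suc i)) (there p)))
                        (λ { (a , eq) → drop-there (from (img (suc i)) (suc a , cong suc eq)) })
  where
  shift : ∀ {s : Fin _ → Fin _} → ∃[ a ] (zero ∷ suc ∘ s) a ≡ suc i → ∃[ a ] s a ≡ i
  shift (zero  , ())
  shift (suc a , eq) = a , suc-injective eq

image-cons⁺ : ∀ {m k} {s : Fin m → Fin k} {S} →
              IsImage s S → IsImage (zero ∷ suc ∘ s) (true Vec.∷ S)
image-cons⁺ img zero    = mk⇔ (λ _ → zero , refl) (λ _ → here)
image-cons⁺ img (suc i) = mk⇔ (λ { (there p) → Product.map suc (cong suc) (to (img i) p) })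
                              (λ { (suc a , eq) → there (from (img i) (a , suc-injective eq)) })

image-size : ∀ {m k} {s : Fin m → Fin k} {S} → StrictInc s → IsImage s S → ∣ S ∣ ≡ m
image-size {zero}  {S = Vec.[]} _ _ = refl
image-size {suc m} {s = s} {Vec.[]} _ _ with () ← s zero
image-size {S = true Vec.∷ S} s↑ img with split s↑
... | hitsZero s′ s′↑ eq = cong suc (image-size s′↑ (image-cons⁻ (IsImage-resp eq img)))
... | avoidsZero _ _ eq  = let a , sa≡0 = to (img zero) here in ⊥-elim (0≢1+n (trans (sym sa≡0) (eq a)))
image-size {S = false Vec.∷ S} s↑ img with split s↑
... | hitsZero _ _ eq     = case from (img zero) (zero , eq zero) of λ ()
... | avoidsZero s′ s′↑ eq = image-size s′↑ (image-suc⁻ (IsImage-resp eq img))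

increasingEnumeration : ∀ {k} (S : Subset k) →
                        Σ (Fin ∣ S ∣ → Fin k) λ g → StrictInc g × IsImage g S
increasingEnumeration Vec.[] = (λ ()) , (λ ()) , λ ()
increasingEnumeration (true Vec.∷ S) =
  let g , g↑ , img = increasingEnumeration S in zero ∷ suc ∘ g , StrictInc-cons g↑ , image-cons⁺ img
increasingEnumeration (false Vec.∷ S) =
  let g , g↑ , img = increasingEnumeration S in suc ∘ g , StrictInc-suc g↑ , image-suc⁺ img

AllOn : ∀ {m a K ℓ} → Pred (Fin m → Fin K) ℓ → (Fin a → Fin K) → Set ℓ
AllOn {m} Q f = ∀ (t : Fin m → _) → StrictInc t → Q (f ∘ t)

Homogeneous : ∀ {m a K ℓ} → Pred (Fin m → Fin K) ℓ → (Fin a → Fin K) → Set ℓ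
Homogeneous Q f = AllOn Q f ⊎ AllOn (∁ Q) f

HomogeneousSeq : ∀ {m K ℓ} (a : ℕ) → Pred (Fin m → Fin K) ℓ → Set ℓ
HomogeneousSeq a Q = Σ (Fin a → Fin _) λ f → StrictInc f × AllOn Q f

Ramsey : ℕ → ℕ → ℕ → Set₁
Ramsey m a b = ∃[ K ] ∀ (Q : Pred (Fin m → Fin K) 0ℓ) → Q Respects _≗_ → Decidable Q →
               HomogeneousSeq a Q ⊎ HomogeneousSeq b (∁ Q)

∁-respects : ∀ {A B : Set} {Q : Pred (A → B) 0ℓ} → Q Respects _≗_ → ∁ Q Respects _≗_
∁-respects resp eq ¬q q = ¬q (resp (sym ∘ eq) q)

AllOn-∘ : ∀ {m a b K ℓ} {Q : Pred (Fin m → Fin K) ℓ} {f : Fin a → Fin K} {g : Fin b → Fin a} →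
          AllOn Q f → StrictInc g → AllOn Q (f ∘ g)
AllOn-∘ all g↑ t t↑ = all _ (StrictInc-∘ g↑ t↑)

Homogeneous-∘ : ∀ {m a b K ℓ} {Q : Pred (Fin m → Fin K) ℓ} {f : Fin a → Fin K} {g : Fin b → Fin a} →
                Homogeneous Q f → StrictInc g → Homogeneous Q (f ∘ g)
Homogeneous-∘ {Q = Q} {f} hom g↑ =
  Sum.map (λ all → AllOn-∘ {Q = Q} {f = f} all g↑) (λ none → AllOn-∘ {Q = ∁ Q} {f = f} none g↑) hom

-- An increasing tuple from zero ∷ suc ∘ h either starts at zero or lies in suc ∘ h.
AllOn-cons : ∀ {m a K} {P : Pred (Fin (suc m) → Fin (suc K)) 0ℓ} {h : Fin a → Fin K} →
             P Respects _≗_ → (∀ t → StrictInc t → P (zero ∷ suc ∘ h ∘ t)) →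
             AllOn P (suc ∘ h) → AllOn P (zero ∷ suc ∘ h)
AllOn-cons {h = h} resp head tail t t↑ with split t↑
... | hitsZero t′ t′↑ eq   = resp (λ i → sym (trans (cong (zero ∷ suc ∘ h) (eq i)) (cons-∘ i)))
                                  (head t′ t′↑)
  where
  cons-∘ : (zero ∷ suc ∘ h) ∘ (zero ∷ suc ∘ t′) ≗ zero ∷ suc ∘ h ∘ t′
  cons-∘ zero    = refl
  cons-∘ (suc i) = refl
... | avoidsZero t′ t′↑ eq = resp (λ i → sym (cong (zero ∷ suc ∘ h) (eq i))) (tail t′ t′↑)

-- R(m+1; a+1, b+1) ≤ 1 + R(m; R(m+1; a, b+1), R(m+1; a+1, b)): an m-tuple of the
-- remaining indices is coloured by the colour of its extension by the first index.
ramsey-suc : ∀ {m a b} (r₁ : Ramsey (suc m) a (suc b)) (r₂ : Ramsey (suc m) (suc a) b) →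
             Ramsey m (proj₁ r₁) (proj₁ r₂) → Ramsey (suc m) (suc a) (suc b)
ramsey-suc (_ , r₁) (_ , r₂) (K , r) = suc K , choose
  where
  link : ∀ {m} → (Fin m → Fin K) → Fin (suc m) → Fin (suc K)
  link t = zero ∷ suc ∘ t
  choose : ∀ Q → Q Respects _≗_ → Decidable Q → _
  choose Q resp Q? with r (Q ∘ link) (λ eq → resp λ { zero → refl ; (suc i) → cong suc (eq i) })
                          (Q? ∘ link)
  ... | inj₁ (f , f↑ , all₀) =
    case r₁ (Q ∘ ((suc ∘ f) ∘_)) (λ eq → resp (cong (suc ∘ f) ∘ eq))
            (Q? ∘ ((suc ∘ f) ∘_)) of λ where
      (inj₁ (f′ , f′↑ , all)) →
        inj₁ (link (f ∘ f′) , StrictInc-cons (StrictInc-∘ f↑ f′↑) ,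
              AllOn-cons resp (AllOn-∘ {Q = Q ∘ link} {f = f} all₀ f′↑) all)
      (inj₂ (g , g↑ , none)) → inj₂ (suc ∘ f ∘ g , StrictInc-suc (StrictInc-∘ f↑ g↑) , none)
  ... | inj₂ (g , g↑ , none₀) =
    case r₂ (Q ∘ ((suc ∘ g) ∘_)) (λ eq → resp (cong (suc ∘ g) ∘ eq))
            (Q? ∘ ((suc ∘ g) ∘_)) of λ where
      (inj₁ (f , f↑ , all)) → inj₁ (suc ∘ g ∘ f , StrictInc-suc (StrictInc-∘ g↑ f↑) , all)
      (inj₂ (g′ , g′↑ , none)) →
        inj₂ (link (g ∘ g′) , StrictInc-cons (StrictInc-∘ g↑ g′↑) ,
              AllOn-cons (∁-respects resp) (AllOn-∘ {Q = ∁ (Q ∘ link)} {f = g} none₀ g′↑) none)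

ramsey : ∀ m a b → Ramsey m a b
ramsey zero a b = a + b , choose
  where
  choose : ∀ Q → Q Respects _≗_ → Decidable Q → _
  choose Q resp Q? with Q? (λ ())
  ... | yes q = inj₁ ((_↑ˡ b) , StrictInc-↑ˡ b , λ _ _ → resp (λ ()) q)
  ... | no ¬q = inj₂ ((a ↑ʳ_) , StrictInc-↑ʳ a , λ _ _ q → ¬q (resp (λ ()) q))
ramsey (suc m) zero b = 0 , λ _ _ _ → inj₁ ((λ ()) , (λ ()) , λ t → case t zero of λ ())
ramsey (suc m) (suc a) zero = 0 , λ _ _ _ → inj₂ ((λ ()) , (λ ()) , λ t → case t zero of λ ())
ramsey (suc m) (suc a) (suc b) =
  ramsey-suc (ramsey (suc m) a (suc b)) (ramsey (suc m) (suc a) b)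
             (ramsey m (proj₁ (ramsey (suc m) a (suc b))) (proj₁ (ramsey (suc m) (suc a) b)))

ramsey-homogeneous : ∀ m k → ∃[ K ] ∀ (Q : Pred (Fin m → Fin K) 0ℓ) → Q Respects _≗_ → Decidable Q →
                     Σ (Fin k → Fin K) λ f → StrictInc f × Homogeneous Q f
ramsey-homogeneous m k with ramsey m k k
... | K , choose = K , λ Q resp Q? → case choose Q resp Q? of λ where
  (inj₁ (f , f↑ , all))  → f , f↑ , inj₁ all
  (inj₂ (g , g↑ , none)) → g , g↑ , inj₂ none

module _ {X : Set} (arity : X → ℕ) where

  simultaneousRamsey :
    (xs : List X) (k : ℕ) →
    ∃[ K ] ∀ (Q : (x : X) → Pred (Fin (arity x) → Fin K) 0ℓ) →
      (∀ x → Q x Respects _≗_) → (∀ x → Decidable (Q x)) →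
      Σ (Fin k → Fin K) λ f → StrictInc f × (∀ {x} → x ∈ᴸ xs → Homogeneous (Q x) f)
  simultaneousRamsey List.[] k = k , λ _ _ _ → id , (λ _ _ i<j → i<j) , λ ()
  simultaneousRamsey (x List.∷ xs) k = K , choose
    where
    K′ = proj₁ (simultaneousRamsey xs k)
    K  = proj₁ (ramsey-homogeneous (arity x) K′)
    choose : ∀ Q → (∀ x → Q x Respects _≗_) → (∀ x → Decidable (Q x)) → _
    choose Q resp Q? =
      let f , f↑ , homₓ = proj₂ (ramsey-homogeneous (arity x) K′) (Q x) (resp x) (Q? x)
          g , g↑ , homs = proj₂ (simultaneousRamsey xs k) (λ y → Q y ∘ (f ∘_))
                            (λ y eq → resp y (cong f ∘ eq)) (λ y → Q? y ∘ (f ∘_))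
      in  f ∘ g , StrictInc-∘ f↑ g↑ , λ where
            (Any.here refl) → Homogeneous-∘ {Q = Q x} {f = f} homₓ g↑
            (Any.there x∈xs) → homs x∈xs

vectors : ∀ {A : Set} → List A → (n : ℕ) → List (Vec A n)
vectors xs zero    = [ Vec.[] ]
vectors xs (suc n) = cartesianProductWith Vec._∷_ xs (vectors xs n)

∈-vectors : ∀ {A : Set} {xs : List A} → (∀ a → a ∈ᴸ xs) → ∀ {n} (v : Vec A n) → v ∈ᴸ vectors xs n
∈-vectors complete Vec.[]       = Any.here refl
∈-vectors complete (a Vec.∷ v) = ∈-cartesianProductWith⁺ Vec._∷_ (complete a) (∈-vectors complete v)

booleans : List Bool
booleans = true List.∷ false List.∷ List.[]

∈-booleans : ∀ b → b ∈ᴸ booleans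
∈-booleans true  = Any.here refl
∈-booleans false = Any.there (Any.here refl)

-- An ordered tree on Fin m is coded by its adjacency matrix, so that finitely many
-- codes cover all ordered trees of bounded order.
TreeCode : Set
TreeCode = Σ ℕ λ m → Vec (Vec Bool m) m

adjacencyMatrix : ∀ {m} → Graph m → Vec (Vec Bool m) m
adjacencyMatrix T = tabulate λ a → tabulate (adj T a)

lookup-adjacencyMatrix : ∀ {m} (T : Graph m) a b → lookup (lookup (adjacencyMatrix T) a) b ≡ adj T a b
lookup-adjacencyMatrix T a b =
  trans (cong (λ row → lookup row b) (lookup∘tabulate _ a)) (lookup∘tabulate (adj T a) b)

codesOfOrder : ℕ → List TreeCode
codesOfOrder m = map (m ,_) (vectors (vectors booleans m) m)

codes : ℕ → List TreeCode
codes τ = concatMap codesOfOrder (upTo (suc τ))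

∈-codes : ∀ {m τ} → m ≤ τ → (A : Vec (Vec Bool m) m) → (m , A) ∈ᴸ codes τ
∈-codes {m} m≤τ A = ∈-concatMap⁺ codesOfOrder
  (lose (∈-upTo⁺ (s≤s m≤τ)) (∈-map⁺ (m ,_) (∈-vectors (∈-vectors ∈-booleans) A)))

∃-Vec? : ∀ {n m} {R : Vec (Fin n) m → Set} → Decidable R → Dec (∃ R)
∃-Vec? {m = zero} R? with R? Vec.[]
... | yes r = yes (Vec.[] , r)
... | no ¬r = no λ { (Vec.[] , r) → ¬r r }
∃-Vec? {m = suc m} R? with any? (λ x → ∃-Vec? (R? ∘ (x Vec.∷_)))
... | yes (x , v , r) = yes (x Vec.∷ v , r)
... | no ¬r = no λ { (x Vec.∷ v , r) → ¬r (x , v , r) }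

module _ {n} (G : Graph n) where

  HasCopy : ∀ {K} → (Fin K → Subset n) → (c : TreeCode) → Pred (Fin (proj₁ c) → Fin K) 0ℓ
  HasCopy Bl (m , A) t =
    Σ (Vec (Fin n) m) λ v → (∀ a → lookup v a ∈ Bl (t a))
      × (∀ a b → a ≢ b → adj G (lookup v a) (lookup v b) ≡ lookup (lookup A a) b)

  HasCopy-respects : ∀ {K} (Bl : Fin K → Subset n) c → HasCopy Bl c Respects _≗_
  HasCopy-respects Bl (m , A) eq (v , inBl , ind) =
    v , (λ a → subst (λ i → lookup v a ∈ Bl i) (eq a) (inBl a)) , ind

  HasCopy? : ∀ {K} (Bl : Fin K → Subset n) c → Decidable (HasCopy Bl c)
  HasCopy? Bl (m , A) t = ∃-Vec? λ v →
    all? (λ a → lookup v a ∈? Bl (t a))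
    ×-dec all? (λ a → all? λ b →
             ¬? (a Fin.≟ b) →-dec (adj G (lookup v a) (lookup v b) Bool.≟ lookup (lookup A a) b))

  module _ {k m} {Bl : Fin k → Subset n} {J : OrderedTree m} where

    HasCopy-support : (H : RainbowCopy G Bl J) → HasCopy Bl (m , adjacencyMatrix (tree J)) (s H)
    HasCopy-support H =
      tabulate (h H) ,
      (λ a → subst (_∈ Bl (s H a)) (sym (lookup∘tabulate (h H) a)) (inBlk H a)) ,
      λ a b a≢b → trans (cong₂ (adj G) (lookup∘tabulate (h H) a) (lookup∘tabulate (h H) b))
                        (trans (induced H a b a≢b) (sym (lookup-adjacencyMatrix (tree J) a b)))

    copyOn : ∀ {t} → StrictInc t → HasCopy Bl (m , adjacencyMatrix (tree J)) t → RainbowCopy G Bl J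
    copyOn     _  c .h       = lookup (proj₁ c)
    copyOn {t} _  _ .s       = t
    copyOn     t↑ _ .s-inc   = t↑
    copyOn     _  c .inBlk   = proj₁ (proj₂ c)
    copyOn     _  c .induced a b a≢b =
      trans (proj₂ (proj₂ c) a b a≢b) (lookup-adjacencyMatrix (tree J) a b)

  trace-dichotomy : ∀ {k K m} {Bl : Fin K → Subset n} {f : Fin k → Fin K} (J : OrderedTree m) →
                    Homogeneous (HasCopy Bl (m , adjacencyMatrix (tree J))) f →
                    (∀ S → ¬ InTrace G (Bl ∘ f) J S) ⊎ (∀ S → InTrace G (Bl ∘ f) J S ⇔ (∣ S ∣ ≡ m))
  trace-dichotomy J (inj₁ all) = inj₂ λ S → mk⇔
    (λ (H , supp) → image-size (s-inc H) supp)
    λ { refl → let g , g↑ , img = increasingEnumeration S in copyOn {J = J} g↑ (all g g↑) , img }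
  trace-dichotomy J (inj₂ none) = inj₁ λ S (H , _) → none (s H) (s-inc H) (HasCopy-support H)

mainTheorem7 : (k τ : ℕ) → 1 ≤ τ →
    ∃[ K ] (∀ (n : ℕ) (G : Graph n) (B : Blockade G K) →
    Σ (Fin k → Fin K) λ f → StrictInc f × SupportUniform τ G (subBlock B f))
mainTheorem7 k τ _ with simultaneousRamsey proj₁ (codes τ) k
... | K , choose = K , λ n G B →
  let f , f↑ , hom = choose (HasCopy G (block B)) (HasCopy-respects G (block B)) (HasCopy? G (block B))
  in  f , f↑ , λ m J m≤τ →
        trace-dichotomy G {Bl = block B} {f} J (hom (∈-codes m≤τ (adjacencyMatrix (tree J))))
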